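{- Let $r\geq 2$ be an even number. Then $C_{S(2^r)^*}\leq 4$.
   Context: For a natural number $m$, $\mathbb Z_m=\mathbb Z/m\mathbb Z$ and $S(m)^*=\{x^2:x\in\mathbb Z_m\}\setminus\{0\}$. For $A\subseteq\mathbb Z_m$, a subsequence $T$ of a sequence $(x_1,\dots,x_k)$ in $\mathbb Z_m$, with nonempty index set $I$, is an $A$-weighted zero-sum subsequence if there exist $a_i\in A$ ($i\in I$) with $\sum_{i\in I}a_ix_i=0$. $C_{S(m)^*}$ is the least positive integer $k$ such that every sequence of length $k$ in $\mathbb Z_m$ has an $S(m)^*$-weighted zero-sum subsequence consisting of consecutive terms. -}

module Defs where

open import Data.Nat using (ℕ; zero; suc; _+_; _*_; _≤_; NonZero)
open import Data.Nat.DivMod using (_%_)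
open import Data.Nat.Divisibility using (_∣_)
open import Data.Fin using (Fin; toℕ)
open import Data.List using (List; []; _∷_; _++_; length; zipWith)
open import Data.Nat.ListAction using (sum)
open import Data.List.Relation.Unary.All using (All)
open import Data.Product using (Σ; ∃; ∃-syntax; _×_)
open import Relation.Binary.PropositionalEquality using (_≡_; _≢_)

-- ℤ_m is represented by Fin m (canonical residues 0,…,m-1).

InSstar : (m : ℕ) .{{_ : NonZero m}} → Fin m → Set
InSstar m a = (Σ (Fin m) λ x → (toℕ a ≡ (toℕ x * toℕ x) % m)) × (toℕ a ≢ 0)

-- The (index-aligned) weighted sum Σ a_i x_i, computed in ℕ.
wsum : {m : ℕ} → List (Fin m) → List (Fin m) → ℕ
wsum ws xs = sum (zipWith (λ a x → toℕ a * toℕ x) ws xs)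

WeightedZeroSum : (m : ℕ) .{{_ : NonZero m}} → List (Fin m) → Set
WeightedZeroSum m ys =
  ys ≢ [] ×
  ∃[ ws ] (length ws ≡ length ys × All (InSstar m) ws × m ∣ wsum ws ys)

HasConsecutiveWZS : (m : ℕ) .{{_ : NonZero m}} → List (Fin m) → Set
HasConsecutiveWZS m xs =
  ∃[ pre ] ∃[ mid ] ∃[ post ] (xs ≡ pre ++ mid ++ post × WeightedZeroSum m mid)

Good : (m : ℕ) .{{_ : NonZero m}} → ℕ → Set
Good m k = (xs : List (Fin m)) → length xs ≡ k → HasConsecutiveWZS m xs

-- C_{S(m)*} ≤ c : the least positive k with Good m k exists and is ≤ c,
-- i.e. some positive k ≤ c satisfies Good m k.
C-Sstar-≤ : (m : ℕ) .{{_ : NonZero m}} → ℕ → Set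
C-Sstar-≤ m c = ∃[ k ] (1 ≤ k × k ≤ c × Good m k)

-- Write r = 2k and put w = 4^(k-1) = (2^(k-1))², a nonzero square modulo m = 2^r = 4^k.
-- Since w·y ≡ 0 (mod m) exactly when 4 ∣ y, weighting every term of a block by w makes it a
-- weighted zero-sum as soon as its ordinary sum is divisible by 4.  Among any 4 integers such a
-- block of consecutive terms exists: two of the 5 prefix sums agree modulo 4, and the block
-- between them works.
module Submission where

open import Defs
open import Data.Nat using (ℕ; zero; suc; _+_; _*_; _∸_; _^_; _≤_; _<_; NonZero; ≢-nonZero⁻¹; z≤n; s≤s; s≤s⁻¹; s<s)
open import Data.Nat.Properties
open import Data.Nat.DivMod using (_%_; _/_; _mod_; m≡m%n+[m/n]*n; m%n<n; m<n⇒m%n≡m)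
open import Data.Nat.Divisibility using (_∣_; divides; ∣-refl; ∣n⇒∣m*n)
open import Data.Nat.ListAction using (sum)
open import Data.Fin using (Fin; toℕ; fromℕ<)
open import Data.Fin.Properties using (toℕ-fromℕ<; toℕ<n; pigeonhole)
open import Data.List using (List; []; _∷_; _++_; length; map; take; drop; replicate)
open import Data.List.Properties using (take++drop≡id; length-replicate)
open import Data.List.Relation.Unary.All using (All; []; _∷_)
open import Data.Product using (∃-syntax; _×_; _,_)
open import Relation.Binary.PropositionalEquality using (_≡_; _≢_; refl; sym; trans; cong; cong₂; subst; module ≡-Reasoning)
open ≡-Reasoning

m%n≡[m+o]%n⇒n∣o : ∀ m o n .{{_ : NonZero n}} → m % n ≡ (m + o) % n → n ∣ o
m%n≡[m+o]%n⇒n∣o m o n eq = divides ((m + o) / n ∸ m / n) (begin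
  o                                                     ≡⟨ m+n∸m≡n m o ⟨
  (m + o) ∸ m                                           ≡⟨ cong₂ _∸_ (m≡m%n+[m/n]*n (m + o) n) (m≡m%n+[m/n]*n m n) ⟩
  ((m + o) % n + (m + o) / n * n) ∸ (m % n + m / n * n) ≡⟨ cong (λ r → (r + (m + o) / n * n) ∸ (m % n + m / n * n)) eq ⟨
  (m % n + (m + o) / n * n) ∸ (m % n + m / n * n)       ≡⟨ [m+n]∸[m+o]≡n∸o (m % n) ((m + o) / n * n) (m / n * n) ⟩
  (m + o) / n * n ∸ m / n * n                           ≡⟨ *-distribʳ-∸ n ((m + o) / n) (m / n) ⟨
  ((m + o) / n ∸ m / n) * n                             ∎)

Segment : ∀ {a} {A : Set a} → (List A → Set) → List A → Set a
Segment P xs = ∃[ pre ] ∃[ mid ] ∃[ post ] (xs ≡ pre ++ mid ++ post × mid ≢ [] × P mid)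

module _ {a} {A : Set a} (f : A → ℕ) where

  sumOf : List A → ℕ
  sumOf xs = sum (map f xs)

  prefixSum : List A → ℕ → ℕ
  prefixSum xs i = sumOf (take i xs)

  segment-between-prefixes : ∀ {i j} (xs : List A) → i < j → j ≤ length xs →
    Segment (λ mid → prefixSum xs i + sumOf mid ≡ prefixSum xs j) xs
  segment-between-prefixes {zero} {suc j} (x ∷ xs) _ _ =
    [] , take (suc j) (x ∷ xs) , drop (suc j) (x ∷ xs) , sym (take++drop≡id (suc j) (x ∷ xs)) , (λ ()) , refl
  segment-between-prefixes {suc i} {suc j} (x ∷ xs) (s<s i<j) (s≤s j≤len)
    with pre , mid , post , xs≡ , mid≢[] , sums ← segment-between-prefixes xs i<j j≤len =
    x ∷ pre , mid , post , cong (x ∷_) xs≡ , mid≢[] , trans (+-assoc (f x) _ _) (cong (f x +_) sums)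

  divisibleSegment : ∀ n .{{_ : NonZero n}} (xs : List A) → n ≤ length xs →
    Segment (λ mid → n ∣ sumOf mid) xs
  divisibleSegment n xs n≤len
    with i , j , i<j , residues≡ ← pigeonhole (s≤s n≤len) (λ i → prefixSum xs (toℕ i) mod n)
    with pre , mid , post , xs≡ , mid≢[] , sums ← segment-between-prefixes xs i<j (s≤s⁻¹ (toℕ<n j)) =
    pre , mid , post , xs≡ , mid≢[] , m%n≡[m+o]%n⇒n∣o (prefixSum xs (toℕ i)) (sumOf mid) n (begin
      prefixSum xs (toℕ i) % n                 ≡⟨ toℕ-fromℕ< (m%n<n (prefixSum xs (toℕ i)) n) ⟨
      toℕ (prefixSum xs (toℕ i) mod n)         ≡⟨ cong toℕ residues≡ ⟩
      toℕ (prefixSum xs (toℕ j) mod n)         ≡⟨ toℕ-fromℕ< (m%n<n (prefixSum xs (toℕ j)) n) ⟩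
      prefixSum xs (toℕ j) % n                 ≡⟨ cong (_% n) sums ⟨
      (prefixSum xs (toℕ i) + sumOf mid) % n   ∎)

module _ (m : ℕ) .{{_ : NonZero m}} {w : Fin m} (w∈S : InSstar m w) where

  wsum-replicate : ∀ (ys : List (Fin m)) → wsum (replicate (length ys) w) ys ≡ toℕ w * sumOf toℕ ys
  wsum-replicate []       = sym (*-zeroʳ (toℕ w))
  wsum-replicate (y ∷ ys) = begin
    toℕ w * toℕ y + wsum (replicate (length ys) w) ys ≡⟨ cong (toℕ w * toℕ y +_) (wsum-replicate ys) ⟩
    toℕ w * toℕ y + toℕ w * sumOf toℕ ys              ≡⟨ *-distribˡ-+ (toℕ w) (toℕ y) (sumOf toℕ ys) ⟨
    toℕ w * sumOf toℕ (y ∷ ys)                        ∎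

  all-replicate : ∀ k → All (InSstar m) (replicate k w)
  all-replicate zero    = []
  all-replicate (suc k) = w∈S ∷ all-replicate k

  uniformWeightedZeroSum : ∀ {n} → m ∣ toℕ w * n → (ys : List (Fin m)) → ys ≢ [] → n ∣ sumOf toℕ ys →
    WeightedZeroSum m ys
  uniformWeightedZeroSum {n} m∣wn ys ys≢[] (divides q sum≡qn) =
    ys≢[] , replicate (length ys) w , length-replicate (length ys) , all-replicate (length ys) ,
    subst (m ∣_) wsum≡q[wn] (∣n⇒∣m*n q m∣wn)
    where
    wsum≡q[wn] : q * (toℕ w * n) ≡ wsum (replicate (length ys) w) ys
    wsum≡q[wn] = begin
      q * (toℕ w * n)                    ≡⟨ *-assoc q (toℕ w) n ⟨
      q * toℕ w * n                      ≡⟨ cong (_* n) (*-comm q (toℕ w)) ⟩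
      toℕ w * q * n                      ≡⟨ *-assoc (toℕ w) q n ⟩
      toℕ w * (q * n)                    ≡⟨ cong (toℕ w *_) sum≡qn ⟨
      toℕ w * sumOf toℕ ys               ≡⟨ wsum-replicate ys ⟨
      wsum (replicate (length ys) w) ys  ∎

  good-of-weight : ∀ n .{{_ : NonZero n}} → m ∣ toℕ w * n → Good m n
  good-of-weight n m∣wn xs len≡n
    with pre , mid , post , xs≡ , mid≢[] , n∣sum ← divisibleSegment toℕ n xs (≤-reflexive (sym len≡n)) =
    pre , mid , post , xs≡ , uniformWeightedZeroSum m∣wn mid mid≢[] n∣sum

square∈Sstar : ∀ {m} .{{_ : NonZero m}} s .{{_ : NonZero s}} (s²<m : s * s < m) → InSstar m (fromℕ< s²<m)
square∈Sstar {m} s s²<m =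
  (fromℕ< s<m , (begin
    toℕ (fromℕ< s²<m)                          ≡⟨ toℕ-fromℕ< s²<m ⟩
    s * s                                      ≡⟨ m<n⇒m%n≡m s²<m ⟨
    (s * s) % m                                ≡⟨ cong (λ t → (t * t) % m) (toℕ-fromℕ< s<m) ⟨
    (toℕ (fromℕ< s<m) * toℕ (fromℕ< s<m)) % m  ∎)) ,
  λ s²≡0 → ≢-nonZero⁻¹ (s * s) {{m*n≢0 s s}} (trans (sym (toℕ-fromℕ< s²<m)) s²≡0)
  where
  s<m : s < m
  s<m = ≤-<-trans (m≤m*n s s) s²<m

C-Sstar-≤-four-times-square : ∀ s .{{_ : NonZero s}} → let m = s * s * 4 in .{{_ : NonZero m}} → C-Sstar-≤ m 4
C-Sstar-≤-four-times-square s =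
  4 , s≤s z≤n , ≤-refl ,
  good-of-weight m (square∈Sstar s s²<m) 4 (subst (m ∣_) (cong (_* 4) (sym (toℕ-fromℕ< s²<m))) ∣-refl)
  where
  m = s * s * 4
  s²<m : s * s < m
  s²<m = m<m*n (s * s) 4 {{m*n≢0 s s}} (s≤s (s≤s z≤n))

2^k*2^k*4≡2^[[1+k]*2] : ∀ k → 2 ^ k * 2 ^ k * 4 ≡ 2 ^ (suc k * 2)
2^k*2^k*4≡2^[[1+k]*2] k = begin
  2 ^ k * 2 ^ k * 4     ≡⟨ cong (_* 4) (^-distribˡ-+-* 2 k k) ⟨
  2 ^ (k + k) * 4       ≡⟨ *-comm (2 ^ (k + k)) 4 ⟩
  2 ^ 2 * 2 ^ (k + k)   ≡⟨ ^-distribˡ-+-* 2 2 (k + k) ⟨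
  2 ^ (2 + (k + k))     ≡⟨ cong (λ e → 2 ^ (2 + e)) (trans (cong (k +_) (sym (+-identityʳ k))) (*-comm 2 k)) ⟩
  2 ^ (suc k * 2)       ∎

theorem4 : (r : ℕ) → 2 ≤ r → 2 ∣ r → C-Sstar-≤ (2 ^ r) {{m^n≢0 2 r}} 4
theorem4 .(zero * 2) () (divides zero refl)
theorem4 .(suc k * 2) _ (divides (suc k) refl) =
  subst (λ m → .{{_ : NonZero m}} → C-Sstar-≤ m 4) (2^k*2^k*4≡2^[[1+k]*2] k)
    (C-Sstar-≤-four-times-square (2 ^ k) {{m^n≢0 2 k}})
    {{m^n≢0 2 (suc k * 2)}}
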